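{- Let $G$ be an $r$-regular graph on $n$ vertices with $\theta(G)=1$, and suppose $G$ is $S$-magic with $S$-magic constant $c$, where $S=\{1,\dots,n+1\}\setminus\{a\}$ for some $a\in\{1,\dots,n\}$. Then $$\frac{nr+r}{2}+\frac{r}{n}\le c\le \frac{nr+3r}{2}.$$
   Context: For a finite set $S$ of positive integers with $|S|=|V(G)|$, a graph $G$ is $S$-magic if there is a bijection $f:V(G)\to S$ and a constant $c$ (the $S$-magic constant) with $\sum_{v\in N(u)} f(v)=c$ for every vertex $u$, where $N(u)$ is the set of neighbours of $u$. Let $\alpha(S)=\max S$ and $i(G)=\min \alpha(S)$ over all $S$ for which $G$ is $S$-magic; the distance magic index is $\theta(G)=i(G)-|V(G)|$. -}

module Defs where

open import Data.Nat using (ℕ; zero; suc; _+_; _*_; _≤_)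
open import Data.Fin using (Fin)
import Data.Fin as F
open import Data.Bool using (Bool; true; false; if_then_else_)
open import Data.Product using (Σ; ∃; _×_)
open import Relation.Binary.PropositionalEquality using (_≡_; _≢_)
open import Relation.Nullary using (¬_)
open import Function.Definitions using (Injective)

record Graph (n : ℕ) : Set where
  field
    adj     : Fin n → Fin n → Bool
    adj-sym : ∀ u v → adj u v ≡ adj v u
    irrefl  : ∀ u → adj u u ≡ false
open Graph public

∑ : ∀ {n} → (Fin n → ℕ) → ℕ
∑ {zero}  g = 0
∑ {suc n} g = g F.zero + ∑ (λ i → g (F.suc i))

nbrSum : ∀ {n} → Graph n → (Fin n → ℕ) → Fin n → ℕ
nbrSum G f u = ∑ (λ v → if adj G u v then f v else 0)

degree : ∀ {n} → Graph n → Fin n → ℕ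
degree G u = nbrSum G (λ _ → 1) u

Regular : ∀ {n} → Graph n → ℕ → Set
Regular G r = ∀ u → degree G u ≡ r

NSet : Set₁
NSet = ℕ → Set

BijOnto : ∀ {n} → (Fin n → ℕ) → NSet → Set
BijOnto {n} f S = Injective _≡_ _≡_ f × (∀ v → S (f v)) × (∀ k → S k → ∃ λ v → f v ≡ k)

-- S is a set of positive integers (finiteness and |S| = |V(G)| follow from BijOnto).
Positive : NSet → Set
Positive S = ∀ k → S k → 1 ≤ k

IsSMagicWith : ∀ {n} → Graph n → NSet → (Fin n → ℕ) → ℕ → Set
IsSMagicWith G S f c = Positive S × BijOnto f S × (∀ u → nbrSum G f u ≡ c)

IsSMagic : ∀ {n} → Graph n → NSet → Set
IsSMagic {n} G S = Σ (Fin n → ℕ) λ f → Σ ℕ λ c → IsSMagicWith G S f c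

MaxIs : NSet → ℕ → Set
MaxIs S m = S m × (∀ k → S k → k ≤ m)

IndexIs : ∀ {n} → Graph n → ℕ → Set₁
IndexIs G m = (Σ NSet λ S → IsSMagic G S × MaxIs S m)
            × (∀ S → IsSMagic G S → ∀ m' → MaxIs S m' → m ≤ m')

ThetaIs : ∀ {n} → Graph n → ℕ → Set₁
ThetaIs {n} G t = IndexIs G (n + t)

SMinus : ℕ → ℕ → NSet
SMinus n a k = 1 ≤ k × k ≤ suc n × k ≢ a

-- Each label f v enters the neighbourhood sums of exactly the r neighbours of v, so
-- n c = r Σ f.  The labels are {1,…,n+1} ∖ {a}, so 2 Σ f = (n+1)(n+2) − 2a, whence
-- 2 n c + 2 r a = r (n+1)(n+2); the bounds on c are this identity with 1 ≤ a ≤ n.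
module Submission where

open import Defs
open import Data.Nat using (ℕ; zero; suc; _+_; _*_; _≤_; _<_; s≤s; z≤n; _≟_; NonZero; >-nonZero)
open import Data.Nat.Properties
open import Data.Nat.Tactic.RingSolver using (solve-∀)
open import Data.Fin using (Fin; toℕ; fromℕ<) renaming (zero to fzero; suc to fsuc)
open import Data.Fin.Properties using (toℕ<n; toℕ-fromℕ<; toℕ-injective)
  renaming (suc-injective to fsuc-injective)
open import Data.Bool using (Bool; true; false; if_then_else_)
open import Data.Product using (_×_; _,_; proj₁; proj₂)
open import Data.Empty using (⊥-elim)
open import Function using (_∘_)
open import Function.Definitions using (Injective)
open import Relation.Binary.PropositionalEquality
open import Relation.Nullary using (Dec; yes; no)

δ : ℕ → ℕ → ℕ
δ x y with x ≟ y
... | yes _ = 1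
... | no _  = 0

δ-≡ : ∀ {x y} → x ≡ y → δ x y ≡ 1
δ-≡ {x} {y} x≡y with x ≟ y
... | yes _   = refl
... | no x≢y  = ⊥-elim (x≢y x≡y)

δ-≢ : ∀ {x y} → x ≢ y → δ x y ≡ 0
δ-≢ {x} {y} x≢y with x ≟ y
... | yes x≡y = ⊥-elim (x≢y x≡y)
... | no _    = refl

∑-cong : ∀ {m} {g h : Fin m → ℕ} → (∀ i → g i ≡ h i) → ∑ g ≡ ∑ h
∑-cong {zero}  g≗h = refl
∑-cong {suc m} g≗h = cong₂ _+_ (g≗h fzero) (∑-cong (g≗h ∘ fsuc))

∑-zero : ∀ {m} {g : Fin m → ℕ} → (∀ i → g i ≡ 0) → ∑ g ≡ 0
∑-zero {zero}  g≡0 = refl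
∑-zero {suc m} g≡0 = cong₂ _+_ (g≡0 fzero) (∑-zero (g≡0 ∘ fsuc))

∑-const : ∀ m x → ∑ {m} (λ _ → x) ≡ m * x
∑-const zero    x = refl
∑-const (suc m) x = cong (x +_) (∑-const m x)

∑-supported : ∀ {m} (g : Fin m → ℕ) (v : Fin m) → (∀ w → w ≢ v → g w ≡ 0) → ∑ g ≡ g v
∑-supported g fzero g≡0 =
  trans (cong (g fzero +_) (∑-zero (λ i → g≡0 (fsuc i) λ ()))) (+-identityʳ _)
∑-supported g (fsuc v) g≡0 = cong₂ _+_ (g≡0 fzero λ ())
  (∑-supported (g ∘ fsuc) v (λ w w≢v → g≡0 (fsuc w) (w≢v ∘ fsuc-injective)))

∑-distrib-+ : ∀ {m} (g h : Fin m → ℕ) → ∑ (λ i → g i + h i) ≡ ∑ g + ∑ h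
∑-distrib-+ {zero}  g h = refl
∑-distrib-+ {suc m} g h = trans
  (cong (g fzero + h fzero +_) (∑-distrib-+ (g ∘ fsuc) (h ∘ fsuc)))
  (+-exch (g fzero) (h fzero) (∑ (g ∘ fsuc)) (∑ (h ∘ fsuc)))
  where
  +-exch : ∀ w x y z → w + x + (y + z) ≡ w + y + (x + z)
  +-exch = solve-∀

*-distribˡ-∑ : ∀ {m} x (g : Fin m → ℕ) → x * ∑ g ≡ ∑ (λ i → x * g i)
*-distribˡ-∑ {zero}  x g = *-zeroʳ x
*-distribˡ-∑ {suc m} x g =
  trans (*-distribˡ-+ x (g fzero) _) (cong (x * g fzero +_) (*-distribˡ-∑ x (g ∘ fsuc)))

∑-comm : ∀ {m k} (h : Fin m → Fin k → ℕ) →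
         ∑ (λ i → ∑ (h i)) ≡ ∑ (λ j → ∑ (λ i → h i j))
∑-comm {zero} {k} h = sym (∑-zero {k} (λ _ → refl))
∑-comm {suc m} h = trans (cong (∑ (h fzero) +_) (∑-comm (h ∘ fsuc)))
                         (sym (∑-distrib-+ (h fzero) _))

twice-∑-toℕ : ∀ m → 2 * ∑ {suc m} toℕ ≡ m * suc m
twice-∑-toℕ zero    = refl
twice-∑-toℕ (suc m) = begin
  2 * ∑ {suc m} (λ k → 1 + toℕ k)          ≡⟨ cong (2 *_) (∑-distrib-+ {suc m} (λ _ → 1) toℕ) ⟩
  2 * (∑ {suc m} (λ _ → 1) + ∑ {suc m} toℕ) ≡⟨ cong (λ s → 2 * (s + ∑ {suc m} toℕ)) (∑-const (suc m) 1) ⟩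
  2 * (suc m * 1 + ∑ {suc m} toℕ)           ≡⟨ *-distribˡ-+ 2 (suc m * 1) _ ⟩
  2 * (suc m * 1) + 2 * ∑ {suc m} toℕ       ≡⟨ cong (2 * (suc m * 1) +_) (twice-∑-toℕ m) ⟩
  2 * (suc m * 1) + m * suc m               ≡⟨ triangle-step m ⟩
  suc m * suc (suc m)                       ∎
  where
  open ≡-Reasoning
  triangle-step : ∀ m → 2 * (suc m * 1) + m * suc m ≡ suc m * suc (suc m)
  triangle-step = solve-∀

∑-toℕ-δ : ∀ {N x} → x < N → ∑ {N} (λ k → toℕ k * δ (toℕ k) x) ≡ x
∑-toℕ-δ {N} {x} x<N = begin
  ∑ {N} (λ k → toℕ k * δ (toℕ k) x) ≡⟨ ∑-supported _ k₀ off-k₀ ⟩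
  toℕ k₀ * δ (toℕ k₀) x             ≡⟨ cong₂ _*_ toℕ-k₀ (δ-≡ toℕ-k₀) ⟩
  x * 1                             ≡⟨ *-identityʳ x ⟩
  x                                 ∎
  where
  open ≡-Reasoning
  k₀ : Fin N
  k₀ = fromℕ< x<N
  toℕ-k₀ : toℕ k₀ ≡ x
  toℕ-k₀ = toℕ-fromℕ< x<N
  off-k₀ : ∀ k → k ≢ k₀ → toℕ k * δ (toℕ k) x ≡ 0
  off-k₀ k k≢k₀ = trans
    (cong (toℕ k *_) (δ-≢ λ k≡x → k≢k₀ (toℕ-injective (trans k≡x (sym toℕ-k₀)))))
    (*-zeroʳ (toℕ k))

multiplicity : ∀ {n} → (Fin n → ℕ) → ℕ → ℕ
multiplicity f k = ∑ (λ v → δ k (f v))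

∑-by-multiplicity : ∀ {n N} (f : Fin n → ℕ) → (∀ v → f v < N) →
                    ∑ f ≡ ∑ {N} (λ k → toℕ k * multiplicity f (toℕ k))
∑-by-multiplicity {n} {N} f f<N = begin
  ∑ f                                               ≡⟨ ∑-cong (λ v → sym (∑-toℕ-δ (f<N v))) ⟩
  ∑ (λ v → ∑ {N} (λ k → toℕ k * δ (toℕ k) (f v)))   ≡⟨ ∑-comm {n} {N} (λ v k → toℕ k * δ (toℕ k) (f v)) ⟩
  ∑ {N} (λ k → ∑ (λ v → toℕ k * δ (toℕ k) (f v)))   ≡⟨ ∑-cong {N} (λ k → sym (*-distribˡ-∑ (toℕ k) (λ v → δ (toℕ k) (f v)))) ⟩
  ∑ {N} (λ k → toℕ k * multiplicity f (toℕ k))      ∎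
  where open ≡-Reasoning

multiplicity-injective : ∀ {n} {f : Fin n → ℕ} {v k} → Injective _≡_ _≡_ f → f v ≡ k →
                         multiplicity f k ≡ 1
multiplicity-injective {f = f} {v} {k} f-inj fv≡k =
  trans (∑-supported _ v off-v) (δ-≡ (sym fv≡k))
  where
  off-v : ∀ w → w ≢ v → δ k (f w) ≡ 0
  off-v w w≢v = δ-≢ λ k≡fw → w≢v (f-inj (trans (sym k≡fw) (sym fv≡k)))

multiplicity-∉ : ∀ {n} {f : Fin n → ℕ} {k} → (∀ v → f v ≢ k) → multiplicity f k ≡ 0
multiplicity-∉ f≢k = ∑-zero λ v → δ-≢ λ k≡fv → f≢k v (sym k≡fv)

multiplicity-SMinus : ∀ {n a} {f : Fin n → ℕ} {k} → BijOnto f (SMinus n a) →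
                      1 ≤ k → k ≤ suc n → multiplicity f k + δ k a ≡ 1
multiplicity-SMinus {a = a} {f} {k} (f-inj , f∈S , S⊆f) 1≤k k≤1+n = by-cases (k ≟ a)
  where
  by-cases : Dec (k ≡ a) → multiplicity f k + δ k a ≡ 1
  by-cases (yes k≡a) =
    cong₂ _+_ (multiplicity-∉ λ v fv≡k → proj₂ (proj₂ (f∈S v)) (trans fv≡k k≡a)) (δ-≡ k≡a)
  by-cases (no k≢a) with S⊆f k (1≤k , k≤1+n , k≢a)
  ... | v , fv≡k = cong₂ _+_ (multiplicity-injective f-inj fv≡k) (δ-≢ k≢a)

∑-SMinus-labelling : ∀ {n a} {f : Fin n → ℕ} → BijOnto f (SMinus n a) → a ≤ suc n →
                     ∑ f + a ≡ ∑ {suc (suc n)} toℕ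
∑-SMinus-labelling {n} {a} {f} bij@(_ , f∈S , _) a≤1+n = begin
  ∑ f + a
    ≡⟨ cong₂ _+_ (∑-by-multiplicity f λ v → s≤s (proj₁ (proj₂ (f∈S v)))) (sym (∑-toℕ-δ (s≤s a≤1+n))) ⟩
  ∑ {N} (λ k → toℕ k * m (toℕ k)) + ∑ {N} (λ k → toℕ k * δ (toℕ k) a)
    ≡⟨ sym (∑-distrib-+ {N} (λ k → toℕ k * m (toℕ k)) (λ k → toℕ k * δ (toℕ k) a)) ⟩
  ∑ {N} (λ k → toℕ k * m (toℕ k) + toℕ k * δ (toℕ k) a)
    ≡⟨ ∑-cong {N} (λ k → sym (*-distribˡ-+ (toℕ k) (m (toℕ k)) (δ (toℕ k) a))) ⟩
  ∑ {N} (λ k → toℕ k * (m (toℕ k) + δ (toℕ k) a))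
    ≡⟨ ∑-cong {N} (λ k → weight (toℕ k) (≤-pred (toℕ<n k))) ⟩
  ∑ {N} toℕ ∎
  where
  open ≡-Reasoning
  N : ℕ
  N = suc (suc n)
  m : ℕ → ℕ
  m = multiplicity f
  weight : ∀ j → j ≤ suc n → j * (m j + δ j a) ≡ j
  weight zero    _     = refl
  weight (suc j) j≤1+n =
    trans (cong (suc j *_) (multiplicity-SMinus bij (s≤s z≤n) j≤1+n)) (*-identityʳ (suc j))

if-scale : ∀ (b : Bool) x → (if b then x else 0) ≡ x * (if b then 1 else 0)
if-scale true  x = sym (*-identityʳ x)
if-scale false x = sym (*-zeroʳ x)

∑-nbrSum : ∀ {n} (G : Graph n) (f : Fin n → ℕ) →
           ∑ (nbrSum G f) ≡ ∑ (λ v → degree G v * f v)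
∑-nbrSum {n} G f = begin
  ∑ (λ u → ∑ (λ v → if adj G u v then f v else 0))
    ≡⟨ ∑-cong (λ u → ∑-cong (λ v → trans (if-scale (adj G u v) (f v)) (cong (λ b → f v * (if b then 1 else 0)) (adj-sym G u v)))) ⟩
  ∑ (λ u → ∑ (λ v → f v * (if adj G v u then 1 else 0)))
    ≡⟨ ∑-comm {n} {n} (λ u v → f v * (if adj G v u then 1 else 0)) ⟩
  ∑ (λ v → ∑ (λ u → f v * (if adj G v u then 1 else 0)))
    ≡⟨ ∑-cong (λ v → sym (*-distribˡ-∑ (f v) (λ u → if adj G v u then 1 else 0))) ⟩
  ∑ (λ v → f v * degree G v)
    ≡⟨ ∑-cong (λ v → *-comm (f v) (degree G v)) ⟩
  ∑ (λ v → degree G v * f v) ∎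
  where open ≡-Reasoning

magic-identity : ∀ {n r a c} (G : Graph n) {f : Fin n → ℕ} → Regular G r →
                 IsSMagicWith G (SMinus n a) f c → a ≤ suc n →
                 2 * n * c + 2 * r * a ≡ r * (suc n * suc (suc n))
magic-identity {n} {r} {a} {c} G {f} regular (_ , bij , magic) a≤1+n = begin
  2 * n * c + 2 * r * a      ≡⟨ cong (_+ 2 * r * a) (*-assoc 2 n c) ⟩
  2 * (n * c) + 2 * r * a    ≡⟨ cong (λ x → 2 * x + 2 * r * a) n*c≡r*∑f ⟩
  2 * (r * ∑ f) + 2 * r * a  ≡⟨ factor-r r (∑ f) a ⟩
  r * (2 * (∑ f + a))        ≡⟨ cong (λ s → r * (2 * s)) (∑-SMinus-labelling bij a≤1+n) ⟩
  r * (2 * ∑ {suc (suc n)} toℕ) ≡⟨ cong (r *_) (twice-∑-toℕ (suc n)) ⟩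
  r * (suc n * suc (suc n))  ∎
  where
  open ≡-Reasoning
  factor-r : ∀ r s a → 2 * (r * s) + 2 * r * a ≡ r * (2 * (s + a))
  factor-r = solve-∀
  n*c≡r*∑f : n * c ≡ r * ∑ f
  n*c≡r*∑f = begin
    n * c                       ≡⟨ sym (∑-const n c) ⟩
    ∑ {n} (λ _ → c)             ≡⟨ ∑-cong (λ u → sym (magic u)) ⟩
    ∑ (nbrSum G f)              ≡⟨ ∑-nbrSum G f ⟩
    ∑ (λ v → degree G v * f v)  ≡⟨ ∑-cong (λ v → cong (_* f v) (regular v)) ⟩
    ∑ (λ v → r * f v)           ≡⟨ sym (*-distribˡ-∑ r f) ⟩
    r * ∑ f                     ∎

magic-constant-upper : ∀ {n r a c} .{{_ : NonZero n}} → 1 ≤ a →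
                       2 * n * c + 2 * r * a ≡ r * (suc n * suc (suc n)) →
                       2 * c ≤ n * r + 3 * r
magic-constant-upper {n} {r} {a} {c} 1≤a identity =
  *-cancelˡ-≤ n (+-cancelʳ-≤ (2 * r) _ _ (begin
    n * (2 * c) + 2 * r          ≡⟨ shift-left n r c ⟩
    2 * n * c + 2 * r * 1        ≤⟨ +-monoʳ-≤ (2 * n * c) (*-monoʳ-≤ (2 * r) 1≤a) ⟩
    2 * n * c + 2 * r * a        ≡⟨ identity ⟩
    r * (suc n * suc (suc n))    ≡⟨ expand n r ⟩
    n * (n * r + 3 * r) + 2 * r  ∎))
  where
  open ≤-Reasoning
  shift-left : ∀ n r c → n * (2 * c) + 2 * r ≡ 2 * n * c + 2 * r * 1
  shift-left = solve-∀
  expand : ∀ n r → r * (suc n * suc (suc n)) ≡ n * (n * r + 3 * r) + 2 * r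
  expand = solve-∀

magic-constant-lower : ∀ {n r a c} → a ≤ n →
                       2 * n * c + 2 * r * a ≡ r * (suc n * suc (suc n)) →
                       n * (n * r + r) + 2 * r ≤ 2 * n * c
magic-constant-lower {n} {r} {a} {c} a≤n identity =
  +-cancelʳ-≤ (2 * r * a) _ _ (begin
    n * (n * r + r) + 2 * r + 2 * r * a  ≤⟨ +-monoʳ-≤ (n * (n * r + r) + 2 * r) (*-monoʳ-≤ (2 * r) a≤n) ⟩
    n * (n * r + r) + 2 * r + 2 * r * n  ≡⟨ expand n r ⟨
    r * (suc n * suc (suc n))            ≡⟨ identity ⟨
    2 * n * c + 2 * r * a                ∎)
  where
  open ≤-Reasoning
  expand : ∀ n r → r * (suc n * suc (suc n)) ≡ n * (n * r + r) + 2 * r + 2 * r * n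
  expand = solve-∀

lemma3 : (n r : ℕ) (G : Graph n) → Regular G r → ThetaIs G 1
         → (a : ℕ) → 1 ≤ a → a ≤ n
         → (f : Fin n → ℕ) (c : ℕ) → IsSMagicWith G (SMinus n a) f c
         → (n * (n * r + r) + 2 * r ≤ 2 * n * c) × (2 * c ≤ n * r + 3 * r)
lemma3 n r G regular _ a 1≤a a≤n f c magic =
  magic-constant-lower a≤n identity ,
  magic-constant-upper {{>-nonZero (≤-trans 1≤a a≤n)}} 1≤a identity
  where
  identity : 2 * n * c + 2 * r * a ≡ r * (suc n * suc (suc n))
  identity = magic-identity G regular magic (m≤n⇒m≤1+n a≤n)
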